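{- Let $n\geq 3$. Define $s=\frac{n-4}{2}$, $u=\frac{3n-6}{2}$ if $n$ is even, and $s=\frac{n-3}{2}$, $u=\frac{3n-7}{2}$ if $n$ is odd; and set $t=n-2-s$, $v=3n-5-u$. Let $E_1=\{\{x,y\}: x+y=n-2,\ 0\leq x\leq s\}=\{\{0,n-2\},\{1,n-3\},\ldots,\{s,t\}\}$, $E_2=\{\{x,y\}: x+y=3n-5,\ n-1\leq x\leq u\}=\{\{n-1,2n-4\},\{n,2n-5\},\ldots,\{u,v\}\}$, $E_3=\{\{\tfrac{n-2}{2},-\infty\},\{2n-3,\infty\}\}$ if $n$ is even and $E_3=\{\{\tfrac{3n-5}{2},-\infty\},\{2n-3,\infty\}\}$ if $n$ is odd, $E_4=\{\{u,-i\infty\},\{v,i\infty\}\}$ if $n$ is even and $E_4=\{\{s,-i\infty\},\{t,i\infty\}\}$ if $n$ is odd. Then $F_1^1=E_1\cup E_2\cup E_3$ is a one-factor (perfect matching) of the complete graph $K_{2n}$ on vertex set $\{0,1,\ldots,2n-3\}\cup\{ -\infty,\infty\}$, and $F_1^2=(F_1^1\cup E_4)\setminus\{\{u,v\}\}$ if $n$ is even, $F_1^2=(F_1^1\cup E_4)\setminus\{\{s,t\}\}$ if $n$ is odd, is a one-factor of the complete graph $K_{2n+2}$ on vertex set $\{0,1,\ldots,2n-3\}\cup\{ -\infty,\infty\}\cup\{ -i\infty,i\infty\}$. Moreover $F_1^1$ and $F_1^2$ have precisely $n-1$ edges in common.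
   Context: Here $-\infty,\infty,-i\infty,i\infty$ are simply four distinct symbols used as vertex labels (distinct from the integers $0,\ldots,2n-3$). A one-factor (perfect matching) of a graph is a set of edges such that every vertex lies in exactly one of them. -}

module Defs where

open import Data.Nat using (ℕ; zero; suc; _+_; _*_; _∸_; _≤_; _<_; ⌊_/2⌋)
open import Data.Fin using (Fin; toℕ)
open import Data.Bool using (Bool; true; false; if_then_else_)
open import Data.Empty using (⊥)
open import Data.Unit using (⊤)
open import Data.Sum using (_⊎_)
open import Data.Product using (_×_; Σ; ∃; ∃-syntax)
open import Data.List using (List; length)
open import Data.List.Membership.Propositional using (_∈_)
open import Data.List.Relation.Unary.Unique.Propositional using (Unique)
open import Relation.Binary.PropositionalEquality using (_≡_)
open import Relation.Nullary using (¬_)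

data V (n : ℕ) : Set where
  num  : Fin (2 * n ∸ 2) → V n
  -∞   : V n
  +∞   : V n
  -i∞  : V n
  +i∞  : V n

-- an injective ranking, used only to represent unordered pairs canonically
rank : ∀ {n} → V n → ℕ
rank (num i) = toℕ i
rank {n} -∞  = 2 * n ∸ 2
rank {n} +∞  = 2 * n ∸ 1
rank {n} -i∞ = 2 * n
rank {n} +i∞ = 2 * n + 1

record Edge (n : ℕ) : Set where
  constructor edge
  field
    lo  : V n
    hi  : V n
    ord : rank lo < rank hi
open Edge public

EdgeSet : ℕ → Set₁
EdgeSet n = Edge n → Set

_∈ₑ_ : ∀ {n} → V n → Edge n → Set
v ∈ₑ e = v ≡ lo e ⊎ v ≡ hi e

-- the edge {x , y} belongs to the set described by the ordered condition P
-- (i.e. {x,y} ∈ {{a,b} : P a b})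
Sym : ∀ {n} → (V n → V n → Set) → EdgeSet n
Sym P e = P (lo e) (hi e) ⊎ P (hi e) (lo e)

IsNum : ∀ {n} → V n → ℕ → Set
IsNum (num i) k = toℕ i ≡ k
IsNum -∞ k = ⊥
IsNum +∞ k = ⊥
IsNum -i∞ k = ⊥
IsNum +i∞ k = ⊥

IsOneFactor : ∀ {n} → (V n → Set) → EdgeSet n → Set
IsOneFactor {n} S F =
  (∀ e → F e → S (lo e) × S (hi e)) ×
  (∀ v → S v →
     (∃[ e ] (F e × v ∈ₑ e)) ×
     (∀ e e′ → F e → v ∈ₑ e → F e′ → v ∈ₑ e′ → e ≡ e′))

VK2n : ∀ {n} → V n → Set
VK2n (num _) = ⊤
VK2n -∞ = ⊤
VK2n +∞ = ⊤
VK2n -i∞ = ⊥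
VK2n +i∞ = ⊥

VK2n+2 : ∀ {n} → V n → Set
VK2n+2 _ = ⊤

isEven : ℕ → Bool
isEven zero = true
isEven (suc zero) = false
isEven (suc (suc n)) = isEven n

sP : ℕ → ℕ
sP n = if isEven n then ⌊ (n ∸ 4) /2⌋ else ⌊ (n ∸ 3) /2⌋

uP : ℕ → ℕ
uP n = if isEven n then ⌊ (3 * n ∸ 6) /2⌋ else ⌊ (3 * n ∸ 7) /2⌋

tP : ℕ → ℕ
tP n = n ∸ 2 ∸ sP n

vP : ℕ → ℕ
vP n = 3 * n ∸ 5 ∸ uP n

-- the vertex matched to -∞ in E₃
cP : ℕ → ℕ
cP n = if isEven n then ⌊ (n ∸ 2) /2⌋ else ⌊ (3 * n ∸ 5) /2⌋

-- the endpoints of E₄ (to -i∞ and i∞); {pP , qP} is the removed edge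
pP : ℕ → ℕ
pP n = if isEven n then uP n else sP n

qP : ℕ → ℕ
qP n = if isEven n then vP n else tP n

E₁ : (n : ℕ) → EdgeSet n
E₁ n = Sym λ x y → ∃[ a ] ∃[ b ] (IsNum x a × IsNum y b × a + b ≡ n ∸ 2 × a ≤ sP n)

E₂ : (n : ℕ) → EdgeSet n
E₂ n = Sym λ x y → ∃[ a ] ∃[ b ]
  (IsNum x a × IsNum y b × a + b ≡ 3 * n ∸ 5 × n ∸ 1 ≤ a × a ≤ uP n)

E₃ : (n : ℕ) → EdgeSet n
E₃ n = Sym λ x y → (IsNum x (cP n) × y ≡ -∞) ⊎ (IsNum x (2 * n ∸ 3) × y ≡ +∞)

E₄ : (n : ℕ) → EdgeSet n
E₄ n = Sym λ x y → (IsNum x (pP n) × y ≡ -i∞) ⊎ (IsNum x (qP n) × y ≡ +i∞)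

Single : (n a b : ℕ) → EdgeSet n
Single n a b = Sym λ x y → IsNum x a × IsNum y b

F₁¹ : (n : ℕ) → EdgeSet n
F₁¹ n e = E₁ n e ⊎ E₂ n e ⊎ E₃ n e

F₁² : (n : ℕ) → EdgeSet n
F₁² n e = (F₁¹ n e ⊎ E₄ n e) × ¬ Single n (pP n) (qP n) e

CommonCount : ∀ {n} → EdgeSet n → EdgeSet n → ℕ → Set
CommonCount {n} F G k =
  Σ (List (Edge n)) λ l → Unique l × length l ≡ k ×
    (∀ e → (e ∈ l → F e × G e) × (F e × G e → e ∈ l))

module Submission where

-- An edge set is a one-factor as soon as it is the graph of a fixed-point-free
-- involution ("partner") of the vertex set (Matching, matching⇒oneFactor).
-- F₁¹ is such a graph: the labels 0, …, n-2 are paired by the reflection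
-- a ↦ (n-2) - a, the labels n-1, …, 2n-4 by a ↦ (3n-5) - a, the centre of the
-- reflection with an even sum is joined to -∞, and 2n-3 to ∞ (Reflection,
-- Construction.matching₁).  F₁² arises from F₁¹ by deleting the edge {p, q}
-- and joining p and q to the new vertices -i∞ and i∞, which again gives a
-- matching (Rewiring).  The common edges are those of F₁¹ other than {p, q};
-- listing them by their lower ends (edgesAbove) and deleting p from the list
-- of all n lower ends (length-delete) counts n - 1 of them.

open import Defs
open import Data.Nat using (ℕ; zero; suc; _+_; _*_; _∸_; _≤_; _<_; _≟_; _<?_; _≤?_; z≤n; s≤s; ⌊_/2⌋)
open import Data.Nat.Properties
open import Data.Fin using (toℕ; fromℕ<)
open import Data.Fin.Properties using (toℕ<n; toℕ-fromℕ<; fromℕ<-toℕ)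
open import Data.Empty using (⊥; ⊥-elim)
open import Data.Unit using (tt)
open import Data.Bool using (true; false; if_then_else_)
open import Data.Sum using (_⊎_; inj₁; inj₂)
open import Data.Product using (_×_; _,_; Σ-syntax; ∃-syntax; proj₁; proj₂)
open import Relation.Binary using (DecidableEquality; tri<; tri≈; tri>)
open import Relation.Binary.PropositionalEquality
open import Relation.Nullary using (¬_; Dec; yes; no)
open import Relation.Nullary.Decidable using (map′; ¬?)
open import Data.Nat.Tactic.RingSolver using (solve-∀)
open import Function using (_∘_)
open import Data.List using (List; []; _∷_; _++_; length; map; filter; applyUpTo)
open import Data.List.Properties using (length-++; length-map; length-applyUpTo; filter-all; map-∘; map-id-local)
open import Data.List.Membership.Propositional using (_∈_; mapWith∈)
open import Data.List.Membership.Propositional.Properties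
  using (∈-++⁺ˡ; ∈-++⁺ʳ; ∈-++⁻; ∈-map⁺; ∈-map⁻; ∈-filter⁺; ∈-filter⁻; ∈-applyUpTo⁺; ∈-applyUpTo⁻; map-mapWith∈; mapWith∈-id)
open import Data.List.Membership.Setoid.Properties using (length-mapWith∈)
open import Data.List.Relation.Unary.Any using (here; there)
open import Data.List.Relation.Unary.Any.Properties using (mapWith∈⁺; mapWith∈⁻)
open import Data.List.Relation.Unary.All as All using ([]; _∷_)
open import Data.List.Relation.Unary.AllPairs using ([]; _∷_)
open import Data.List.Relation.Unary.Unique.Propositional using (Unique)
open import Data.List.Relation.Unary.Unique.Propositional.Properties using (map⁻; filter⁺; ++⁺; applyUpTo⁺₁)

module Vertices {n : ℕ} (n>0 : 0 < n) where

  N : ℕ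
  N = 2 * n ∸ 2

  2n≡2+N : 2 * n ≡ 2 + N
  2n≡2+N = sym (m+[n∸m]≡n (*-monoʳ-≤ 2 n>0))

  rank-+∞ : rank {n} +∞ ≡ 1 + N
  rank-+∞ = cong (_∸ 1) 2n≡2+N

  rank-+i∞ : rank {n} +i∞ ≡ 3 + N
  rank-+i∞ = trans (+-comm (2 * n) 1) (cong suc 2n≡2+N)

  symbol : ℕ → V n
  symbol 0 = -∞
  symbol 1 = +∞
  symbol 2 = -i∞
  symbol _ = +i∞

  unrank : ℕ → V n
  unrank a with a <? N
  ... | yes a<N = num (fromℕ< a<N)
  ... | no _ = symbol (a ∸ N)

  unrank-num : ∀ {a} (a<N : a < N) → unrank a ≡ num (fromℕ< a<N)
  unrank-num {a} a<N with a <? N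
  ... | yes _ = refl
  ... | no a≮N = ⊥-elim (a≮N a<N)

  unrank-symbol : ∀ k → unrank (k + N) ≡ symbol k
  unrank-symbol k with k + N <? N
  ... | yes k+N<N = ⊥-elim (m+n≮n k N k+N<N)
  ... | no _ = cong symbol (m+n∸n≡m k N)

  unrank-rank : ∀ x → unrank (rank x) ≡ x
  unrank-rank (num i) = trans (unrank-num (toℕ<n i)) (cong num (fromℕ<-toℕ i (toℕ<n i)))
  unrank-rank -∞ = unrank-symbol 0
  unrank-rank +∞ = trans (cong unrank rank-+∞) (unrank-symbol 1)
  unrank-rank -i∞ = trans (cong unrank 2n≡2+N) (unrank-symbol 2)
  unrank-rank +i∞ = trans (cong unrank rank-+i∞) (unrank-symbol 3)

  rank-injective : ∀ {x y : V n} → rank x ≡ rank y → x ≡ y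
  rank-injective {x} {y} e = trans (sym (unrank-rank x)) (trans (cong unrank e) (unrank-rank y))

  _≟ᵥ_ : DecidableEquality (V n)
  x ≟ᵥ y = map′ rank-injective (cong rank) (rank x ≟ rank y)

  isNum-rank : ∀ {x : V n} {a} → IsNum x a → rank x ≡ a
  isNum-rank {num i} e = e

  isNum-bound : ∀ {x : V n} {a} → IsNum x a → a < N
  isNum-bound {num i} e = subst (_< N) e (toℕ<n i)

  isNum-unrank : ∀ {a} → a < N → IsNum (unrank a) a
  isNum-unrank a<N rewrite unrank-num a<N = toℕ-fromℕ< a<N

  isNum-≡ : ∀ {x : V n} {a} → IsNum x a → x ≡ unrank a
  isNum-≡ {x} p = trans (sym (unrank-rank x)) (cong unrank (isNum-rank p))

  rank-unrank : ∀ {a} → a < N → rank (unrank a) ≡ a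
  rank-unrank a<N = isNum-rank (isNum-unrank a<N)

SymR : ∀ {n} → (V n → V n → Set) → V n → V n → Set
SymR P x y = P x y ⊎ P y x

SymR-swap : ∀ {n} {P : V n → V n → Set} {x y} → SymR P x y → SymR P y x
SymR-swap (inj₁ p) = inj₂ p
SymR-swap (inj₂ p) = inj₁ p

edge-≡ : ∀ {n} {e e′ : Edge n} → lo e ≡ lo e′ → hi e ≡ hi e′ → e ≡ e′
edge-≡ {e = edge x y o} {edge .x .y o′} refl refl = cong (edge x y) (<-irrelevant o o′)

not-reversed : ∀ {n} (e e′ : Edge n) → lo e′ ≡ hi e → hi e′ ≡ lo e → ⊥
not-reversed e e′ l h = <-asym (ord e) (subst₂ (λ a b → rank a < rank b) l h (ord e′))

record Matching {n} (S : V n → Set) (R : V n → V n → Set) : Set where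
  field
    partner     : V n → V n
    symmetric   : ∀ {x y} → R x y → R y x
    inside      : ∀ {x y} → R x y → S x
    determined  : ∀ {x y} → R x y → y ≡ partner x
    total       : ∀ {x} → S x → R x (partner x)
    irreflexive : ∀ {x} → ¬ R x x

module OneFactors {n : ℕ} (n>0 : 0 < n) where
  open Vertices n>0

  edgeBetween : (x y : V n) → x ≢ y → Σ[ e ∈ Edge n ] (lo e ≡ x × hi e ≡ y ⊎ lo e ≡ y × hi e ≡ x)
  edgeBetween x y x≢y with <-cmp (rank x) (rank y)
  ... | tri< x<y _ _ = edge x y x<y , inj₁ (refl , refl)
  ... | tri≈ _ x≡y _ = ⊥-elim (x≢y (rank-injective x≡y))
  ... | tri> _ _ y<x = edge y x y<x , inj₂ (refl , refl)

  matching⇒oneFactor : ∀ {S R} → Matching S R → IsOneFactor S (λ e → R (lo e) (hi e))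
  matching⇒oneFactor {S} {R} M =
    (λ e r → inside r , inside (symmetric r)) , λ v v∈S → covered v∈S , unique
    where
    open Matching M

    covered : ∀ {v} → S v → ∃[ e ] (R (lo e) (hi e) × v ∈ₑ e)
    covered {v} v∈S with edgeBetween v (partner v) (λ v≡w → irreflexive (subst (R v) (sym v≡w) (total v∈S)))
    ... | e , inj₁ (refl , refl) = e , total v∈S , inj₁ refl
    ... | e , inj₂ (refl , refl) = e , symmetric (total v∈S) , inj₂ refl

    ends : ∀ {v} e → R (lo e) (hi e) → v ∈ₑ e →
           lo e ≡ v × hi e ≡ partner v ⊎ hi e ≡ v × lo e ≡ partner v
    ends e r (inj₁ refl) = inj₁ (refl , determined r)
    ends e r (inj₂ refl) = inj₂ (refl , determined (symmetric r))

    unique : ∀ {v} e e′ → R (lo e) (hi e) → v ∈ₑ e → R (lo e′) (hi e′) → v ∈ₑ e′ → e ≡ e′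
    unique e e′ r v∈e r′ v∈e′ with ends e r v∈e | ends e′ r′ v∈e′
    ... | inj₁ (l , h) | inj₁ (l′ , h′) = edge-≡ (trans l (sym l′)) (trans h (sym h′))
    ... | inj₂ (h , l) | inj₂ (h′ , l′) = edge-≡ (trans l (sym l′)) (trans h (sym h′))
    ... | inj₁ (l , h) | inj₂ (h′ , l′) = ⊥-elim (not-reversed e e′ (trans l′ (sym h)) (trans h′ (sym l)))
    ... | inj₂ (h , l) | inj₁ (l′ , h′) = ⊥-elim (not-reversed e e′ (trans l′ (sym h)) (trans h′ (sym l)))

-- Rewiring a matching: delete one of its edges {P, Q} and join P and Q to
-- two new vertices α and β instead.  This is how F₁² arises from F₁¹.
module Rewiring {n : ℕ} (n>0 : 0 < n) {S S′ : V n → Set} {R : V n → V n → Set}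
  (M : Matching S R) {IsP IsQ : V n → Set} {P Q α β : V n}
  (isP⇒ : ∀ {x} → IsP x → x ≡ P) (isP : IsP P) (isQ⇒ : ∀ {x} → IsQ x → x ≡ Q) (isQ : IsQ Q)
  (PQ : R P Q) (α∉S : ¬ S α) (β∉S : ¬ S β) (α≢β : α ≢ β)
  (S′⇒ : ∀ {x} → S′ x → S x ⊎ x ≡ α ⊎ x ≡ β) (⇒S′ : ∀ {x} → S x ⊎ x ≡ α ⊎ x ≡ β → S′ x)
  where
  open Matching M
  open Vertices n>0 using (_≟ᵥ_)

  Attach : V n → V n → Set
  Attach x y = IsP x × y ≡ α ⊎ IsQ x × y ≡ β

  Removed : V n → V n → Set
  Removed x y = IsP x × IsQ y

  Rewired : V n → V n → Set
  Rewired x y = (R x y ⊎ SymR Attach x y) × ¬ SymR Removed x y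

  P∈S : S P
  P∈S = inside PQ

  Q∈S : S Q
  Q∈S = inside (symmetric PQ)

  outside : ∀ {x y} → ¬ S x → S y → x ≢ y
  outside x∉S y∈S refl = x∉S y∈S

  P≢Q : P ≢ Q
  P≢Q P≡Q = irreflexive (subst (R P) (sym P≡Q) PQ)

  removed-ends : ∀ {x y} → SymR Removed x y → (x ≡ P ⊎ x ≡ Q) × (y ≡ P ⊎ y ≡ Q)
  removed-ends (inj₁ (px , qy)) = inj₁ (isP⇒ px) , inj₂ (isQ⇒ qy)
  removed-ends (inj₂ (py , qx)) = inj₂ (isQ⇒ qx) , inj₁ (isP⇒ py)

  neither : ∀ {x} → x ≢ P → x ≢ Q → ¬ (x ≡ P ⊎ x ≡ Q)
  neither x≢P _ (inj₁ x≡P) = x≢P x≡P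
  neither _ x≢Q (inj₂ x≡Q) = x≢Q x≡Q

  partner′ : V n → V n
  partner′ x with x ≟ᵥ P
  ... | yes _ = α
  ... | no _ with x ≟ᵥ Q
  ... | yes _ = β
  ... | no _ with x ≟ᵥ α
  ... | yes _ = P
  ... | no _ with x ≟ᵥ β
  ... | yes _ = Q
  ... | no _ = partner x

  partner′-P : partner′ P ≡ α
  partner′-P with P ≟ᵥ P
  ... | yes _ = refl
  ... | no P≢P = ⊥-elim (P≢P refl)

  partner′-Q : partner′ Q ≡ β
  partner′-Q with Q ≟ᵥ P
  ... | yes Q≡P = ⊥-elim (P≢Q (sym Q≡P))
  ... | no _ with Q ≟ᵥ Q
  ... | yes _ = refl
  ... | no Q≢Q = ⊥-elim (Q≢Q refl)

  partner′-α : partner′ α ≡ P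
  partner′-α with α ≟ᵥ P
  ... | yes α≡P = ⊥-elim (outside α∉S P∈S α≡P)
  ... | no _ with α ≟ᵥ Q
  ... | yes α≡Q = ⊥-elim (outside α∉S Q∈S α≡Q)
  ... | no _ with α ≟ᵥ α
  ... | yes _ = refl
  ... | no α≢α = ⊥-elim (α≢α refl)

  partner′-β : partner′ β ≡ Q
  partner′-β with β ≟ᵥ P
  ... | yes β≡P = ⊥-elim (outside β∉S P∈S β≡P)
  ... | no _ with β ≟ᵥ Q
  ... | yes β≡Q = ⊥-elim (outside β∉S Q∈S β≡Q)
  ... | no _ with β ≟ᵥ α
  ... | yes β≡α = ⊥-elim (α≢β (sym β≡α))
  ... | no _ with β ≟ᵥ β
  ... | yes _ = refl
  ... | no β≢β = ⊥-elim (β≢β refl)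

  partner′-old : ∀ {x} → S x → x ≢ P → x ≢ Q → partner′ x ≡ partner x
  partner′-old {x} x∈S x≢P x≢Q with x ≟ᵥ P
  ... | yes x≡P = ⊥-elim (x≢P x≡P)
  ... | no _ with x ≟ᵥ Q
  ... | yes x≡Q = ⊥-elim (x≢Q x≡Q)
  ... | no _ with x ≟ᵥ α
  ... | yes x≡α = ⊥-elim (outside α∉S x∈S (sym x≡α))
  ... | no _ with x ≟ᵥ β
  ... | yes x≡β = ⊥-elim (outside β∉S x∈S (sym x≡β))
  ... | no _ = refl

  old-edge-at-P : ∀ {y} → R P y → Removed P y
  old-edge-at-P r = isP , subst IsQ (trans (determined PQ) (sym (determined r))) isQ

  old-edge-at-Q : ∀ {y} → R Q y → Removed y Q
  old-edge-at-Q r = subst IsP (trans (determined (symmetric PQ)) (sym (determined r))) isP , isQ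

  symmetric′ : ∀ {x y} → Rewired x y → Rewired y x
  symmetric′ (inj₁ r , ¬rm) = inj₁ (symmetric r) , λ rm → ¬rm (SymR-swap {P = Removed} rm)
  symmetric′ (inj₂ a , ¬rm) = inj₂ (SymR-swap {P = Attach} a) , λ rm → ¬rm (SymR-swap {P = Removed} rm)

  inside′ : ∀ {x y} → Rewired x y → S′ x
  inside′ (inj₁ r , _) = ⇒S′ (inj₁ (inside r))
  inside′ (inj₂ (inj₁ (inj₁ (px , _))) , _) = ⇒S′ (inj₁ (subst S (sym (isP⇒ px)) P∈S))
  inside′ (inj₂ (inj₁ (inj₂ (qx , _))) , _) = ⇒S′ (inj₁ (subst S (sym (isQ⇒ qx)) Q∈S))
  inside′ (inj₂ (inj₂ (inj₁ (_ , x≡α))) , _) = ⇒S′ (inj₂ (inj₁ x≡α))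
  inside′ (inj₂ (inj₂ (inj₂ (_ , x≡β))) , _) = ⇒S′ (inj₂ (inj₂ x≡β))

  determined′ : ∀ {x y} → Rewired x y → y ≡ partner′ x
  determined′ {x} (inj₁ r , ¬rm) = trans (determined r) (sym (partner′-old (inside r) x≢P x≢Q))
    where
    x≢P : x ≢ P
    x≢P refl = ¬rm (inj₁ (old-edge-at-P r))
    x≢Q : x ≢ Q
    x≢Q refl = ¬rm (inj₂ (old-edge-at-Q r))
  determined′ (inj₂ (inj₁ (inj₁ (px , refl))) , _) = sym (trans (cong partner′ (isP⇒ px)) partner′-P)
  determined′ (inj₂ (inj₁ (inj₂ (qx , refl))) , _) = sym (trans (cong partner′ (isQ⇒ qx)) partner′-Q)
  determined′ (inj₂ (inj₂ (inj₁ (py , refl))) , _) = trans (isP⇒ py) (sym partner′-α)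
  determined′ (inj₂ (inj₂ (inj₂ (qy , refl))) , _) = trans (isQ⇒ qy) (sym partner′-β)

  total′ : ∀ {x} → S′ x → Rewired x (partner′ x)
  total′ {x} x∈S′ = by-cases (x ≟ᵥ P) (x ≟ᵥ Q) (S′⇒ x∈S′)
    where
    by-cases : Dec (x ≡ P) → Dec (x ≡ Q) → S x ⊎ x ≡ α ⊎ x ≡ β → Rewired x (partner′ x)
    by-cases (yes refl) _ _ = subst (Rewired P) (sym partner′-P)
      (inj₂ (inj₁ (inj₁ (isP , refl))) , λ rm → neither (outside α∉S P∈S) (outside α∉S Q∈S) (proj₂ (removed-ends rm)))
    by-cases (no _) (yes refl) _ = subst (Rewired Q) (sym partner′-Q)
      (inj₂ (inj₁ (inj₂ (isQ , refl))) , λ rm → neither (outside β∉S P∈S) (outside β∉S Q∈S) (proj₂ (removed-ends rm)))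
    by-cases (no _) (no _) (inj₂ (inj₁ refl)) = subst (Rewired α) (sym partner′-α)
      (inj₂ (inj₂ (inj₁ (isP , refl))) , λ rm → neither (outside α∉S P∈S) (outside α∉S Q∈S) (proj₁ (removed-ends rm)))
    by-cases (no _) (no _) (inj₂ (inj₂ refl)) = subst (Rewired β) (sym partner′-β)
      (inj₂ (inj₂ (inj₂ (isQ , refl))) , λ rm → neither (outside β∉S P∈S) (outside β∉S Q∈S) (proj₁ (removed-ends rm)))
    by-cases (no x≢P) (no x≢Q) (inj₁ x∈S) = subst (Rewired x) (sym (partner′-old x∈S x≢P x≢Q))
      (inj₁ (total x∈S) , λ rm → neither x≢P x≢Q (proj₁ (removed-ends rm)))

  irreflexive′ : ∀ {x} → ¬ Rewired x x
  irreflexive′ (inj₁ r , _) = irreflexive r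
  irreflexive′ (inj₂ (inj₁ (inj₁ (px , x≡α))) , _) = outside α∉S P∈S (trans (sym x≡α) (isP⇒ px))
  irreflexive′ (inj₂ (inj₁ (inj₂ (qx , x≡β))) , _) = outside β∉S Q∈S (trans (sym x≡β) (isQ⇒ qx))
  irreflexive′ (inj₂ (inj₂ (inj₁ (px , x≡α))) , _) = outside α∉S P∈S (trans (sym x≡α) (isP⇒ px))
  irreflexive′ (inj₂ (inj₂ (inj₂ (qx , x≡β))) , _) = outside β∉S Q∈S (trans (sym x≡β) (isQ⇒ qx))

  rewired : Matching S′ Rewired
  rewired = record
    { partner = partner′ ; symmetric = symmetric′ ; inside = inside′
    ; determined = determined′ ; total = total′ ; irreflexive = irreflexive′ }

  survives : rank P < rank Q → ∀ {x y} → R x y → rank x < rank y → x ≢ P → Rewired x y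
  survives P<Q {x} {y} r x<y x≢P = inj₁ r , not-removed
    where
    not-removed : ¬ SymR Removed x y
    not-removed (inj₁ (px , _)) = x≢P (isP⇒ px)
    not-removed (inj₂ (py , qx)) =
      <-asym P<Q (subst₂ (λ a b → rank a < rank b) (isQ⇒ qx) (isP⇒ py) x<y)

  deleted : ∀ {y} → R P y → ¬ Rewired P y
  deleted r (_ , ¬rm) = ¬rm (inj₁ (old-edge-at-P r))

edgesAbove : ∀ {n S R} → Matching {n} S R → (ls : List (V n)) → Unique ls →
  (∀ {x} → x ∈ ls → ∃[ y ] (R x y × rank x < rank y)) →
  Σ[ es ∈ List (Edge n) ] Unique es × length es ≡ length ls ×
    (∀ e → (e ∈ es → R (lo e) (hi e) × lo e ∈ ls) × (R (lo e) (hi e) × lo e ∈ ls → e ∈ es))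
edgesAbove {n} {S} {R} M ls unique-ls lower =
  es , map⁻ (subst Unique (sym lo-es) unique-ls) , length-mapWith∈ (setoid _) ls , λ e → listed e , unlisted e
  where
  open Matching M

  upward : ∀ {x} → x ∈ ls → R x (partner x) × rank x < rank (partner x)
  upward {x} x∈ls with lower x∈ls
  ... | y , r , x<y = subst (R x) (determined r) r , subst (λ z → rank x < rank z) (determined r) x<y

  edgeAt : ∀ {x} → x ∈ ls → Edge n
  edgeAt {x} x∈ls = edge x (partner x) (proj₂ (upward x∈ls))

  es : List (Edge n)
  es = mapWith∈ ls edgeAt

  lo-es : map lo es ≡ ls
  lo-es = trans (map-mapWith∈ ls edgeAt lo) (mapWith∈-id ls)

  listed : ∀ e → e ∈ es → R (lo e) (hi e) × lo e ∈ ls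
  listed e e∈es with mapWith∈⁻ ls edgeAt e∈es
  ... | x , x∈ls , refl = proj₁ (upward x∈ls) , x∈ls

  unlisted : ∀ e → R (lo e) (hi e) × lo e ∈ ls → e ∈ es
  unlisted e (r , lo∈ls) = mapWith∈⁺ edgeAt (lo e , lo∈ls , edge-≡ refl (determined r))

length-delete : ∀ {A : Set} (_≟_ : DecidableEquality A) {x : A} {xs} → Unique xs → x ∈ xs →
                suc (length (filter (λ y → ¬? (y ≟ x)) xs)) ≡ length xs
length-delete _≟_ {x} (x∉ys ∷ _) (here refl) with x ≟ x
... | yes _ = cong suc (cong length (filter-all (λ y → ¬? (y ≟ x)) (All.map (λ x≢y → x≢y ∘ sym) x∉ys)))
... | no x≢x = ⊥-elim (x≢x refl)
length-delete _≟_ {x} {y ∷ _} (y∉ys ∷ unique-ys) (there x∈ys) with y ≟ x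
... | yes y≡x = ⊥-elim (All.lookup y∉ys x∈ys y≡x)
... | no _ = cong suc (length-delete _≟_ unique-ys x∈ys)

interval : ℕ → ℕ → List ℕ
interval a b = applyUpTo (a +_) (b ∸ a)

∈-interval⁻ : ∀ {a b x} → x ∈ interval a b → a ≤ x × x < b
∈-interval⁻ {a} {b} x∈ with ∈-applyUpTo⁻ (a +_) x∈
... | i , i<b∸a , refl = m≤m+n a i , subst (_≤ b) (cong suc (+-comm i a)) (m≤o∸n⇒m+n≤o (suc i) a≤b i<b∸a)
  where
  a≤b : a ≤ b
  a≤b = <⇒≤ (m∸n≢0⇒n<m (λ b∸a≡0 → n≮0 (subst (i <_) b∸a≡0 i<b∸a)))

∈-interval⁺ : ∀ {a b x} → a ≤ x → x < b → x ∈ interval a b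
∈-interval⁺ {a} {b} {x} a≤x x<b =
  subst (_∈ interval a b) (m+[n∸m]≡n a≤x) (∈-applyUpTo⁺ (a +_) (∸-monoˡ-< x<b a≤x))

interval-unique : ∀ a b → Unique (interval a b)
interval-unique a b = applyUpTo⁺₁ (a +_) (b ∸ a) (λ i<j _ → <⇒≢ (+-monoʳ-< a i<j))

-- Reflection in K: the labels a, b with a + b ≡ K are paired, and h is the
-- last label of the lower half, i.e. h = ⌊(K - 1)/2⌋.
module Reflection (K h : ℕ) (lower : 2 * h < K) (upper : K ≤ 2 + 2 * h) where

  2+2h≡ : 2 + 2 * h ≡ suc h + suc h
  2+2h≡ = trans (cong (λ z → 2 + (h + z)) (+-identityʳ h)) (sym (cong suc (+-suc h h)))

  h<K : h < K
  h<K = ≤-<-trans (m≤n*m h 2) lower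

  lower<upper : ∀ {a b} → a + b ≡ K → a ≤ h → a < b
  lower<upper {a} {b} a+b≡K a≤h = ≤-<-trans a≤h (+-cancelˡ-< h h b (begin-strict
    h + h      ≡⟨ cong (h +_) (sym (+-identityʳ h)) ⟩
    2 * h      <⟨ lower ⟩
    K          ≡⟨ sym a+b≡K ⟩
    a + b      ≤⟨ +-monoˡ-≤ b a≤h ⟩
    h + b      ∎))
    where open ≤-Reasoning

  lower-not-centre : ∀ {a} → a ≤ h → 2 * a ≢ K
  lower-not-centre {a} a≤h 2a≡K =
    <-irrefl refl (lower<upper (trans (cong (a +_) (sym (+-identityʳ a))) 2a≡K) a≤h)

  partner-not-centre : ∀ {a b} → a + b ≡ K → a ≤ h → 2 * b ≢ K
  partner-not-centre {a} {b} a+b≡K a≤h 2b≡K = <⇒≢ (lower<upper a+b≡K a≤h) a≡b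
    where
    a≡b : a ≡ b
    a≡b = +-cancelʳ-≡ b a b (trans a+b≡K (trans (sym 2b≡K) (cong (b +_) (+-identityʳ b))))

  halves : ∀ {a b} → a + b ≡ K → a ≤ h ⊎ b ≤ h ⊎ 2 * a ≡ K
  halves {a} {b} a+b≡K with a ≤? h | b ≤? h
  ... | yes a≤h | _ = inj₁ a≤h
  ... | no _ | yes b≤h = inj₂ (inj₁ b≤h)
  ... | no a≰h | no b≰h = inj₂ (inj₂ (begin
    2 * a   ≡⟨ cong (a +_) (+-identityʳ a) ⟩
    a + a   ≡⟨ cong (a +_) (trans a≡1+h (sym b≡1+h)) ⟩
    a + b   ≡⟨ a+b≡K ⟩
    K       ∎))
    where
    open ≡-Reasoning
    sum≤ : a + b ≤ suc h + suc h
    sum≤ = ≤-trans (≤-reflexive a+b≡K) (≤-trans upper (≤-reflexive 2+2h≡))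
    a≡1+h : a ≡ suc h
    a≡1+h = ≤-antisym (+-cancelʳ-≤ (suc h) a (suc h) (≤-trans (+-monoʳ-≤ a (≰⇒> b≰h)) sum≤)) (≰⇒> a≰h)
    b≡1+h : b ≡ suc h
    b≡1+h = ≤-antisym (+-cancelˡ-≤ (suc h) b (suc h) (≤-trans (+-monoˡ-≤ b (≰⇒> a≰h)) sum≤)) (≰⇒> b≰h)

-- K₁ = n-2 and K₂ = 3n-5 are the sums
-- of the edges in E₁ and E₂, L = n-1 is the least label used by E₂, T = 2n-3
-- is the largest label, s and u end the lower halves of the two reflections,
-- c is the label joined to -∞ and {p, q} the edge replaced by E₄.
record Layout (n K₁ s K₂ L u c T p q : ℕ) : Set where
  field
    -- the labels split into the blocks A = [0, K₁] and B = [L, T) and the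
    -- last label T = N - 1; B is reflected in K₂ = L + (T - 1)
    L≡1+K₁   : L ≡ suc K₁
    L≤T      : L ≤ T
    T+L≡1+K₂ : T + L ≡ suc K₂
    1+T≡N    : suc T ≡ 2 * n ∸ 2
    s-lower  : 2 * s < K₁
    s-upper  : K₁ ≤ 2 + 2 * s
    u-lower  : 2 * u < K₂
    u-upper  : K₂ ≤ 2 + 2 * u
    c-centre      : 2 * c ≡ K₁ ⊎ 2 * c ≡ K₂ × L ≤ c × c < T
    centre-unique : ∀ {a} → 2 * a ≡ K₁ ⊎ 2 * a ≡ K₂ → a ≡ c
    pq-edge  : p + q ≡ K₁ × p ≤ s ⊎ p + q ≡ K₂ × L ≤ p × p ≤ u
    -- F₁¹ has (s + 1) + (u + 1 - L) + 2 = n edges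
    edge-count : suc s + (suc u ∸ L) + 2 ≡ n

module Construction (n K₁ s K₂ L u c T p q : ℕ) (n>0 : 0 < n) (layout : Layout n K₁ s K₂ L u c T p q) where
  open Layout layout
  open Vertices n>0
  module A = Reflection K₁ s s-lower s-upper
  module B = Reflection K₂ u u-lower u-upper

  K₁<L : K₁ < L
  K₁<L = ≤-reflexive (sym L≡1+K₁)

  K₁<T : K₁ < T
  K₁<T = <-≤-trans K₁<L L≤T

  T<N : T < N
  T<N = ≤-reflexive 1+T≡N

  below-T : ∀ {a} → a + L ≤ K₂ → a < T
  below-T {a} a+L≤K₂ = +-cancelʳ-< L a T (≤-trans (s≤s a+L≤K₂) (≤-reflexive (sym T+L≡1+K₂)))

  reflect-in-B : ∀ {a} → a < T → a + L ≤ K₂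
  reflect-in-B a<T = ≤-pred (≤-trans (+-monoˡ-< L a<T) (≤-reflexive T+L≡1+K₂))

  lower-in-B : ∀ {a} → L ≤ a → a ≤ u → a + L ≤ K₂
  lower-in-B {a} L≤a a≤u =
    ≤-trans (+-monoʳ-≤ a L≤a) (≤-trans (≤-reflexive (cong (a +_) (sym (+-identityʳ a))))
      (<⇒≤ (≤-<-trans (*-monoʳ-≤ 2 a≤u) u-lower)))

  c≤K₁ : 2 * c ≡ K₁ → c ≤ K₁
  c≤K₁ 2c≡K₁ = subst (c ≤_) 2c≡K₁ (m≤n*m c 2)

  c<N : c < N
  c<N with c-centre
  ... | inj₁ 2c≡K₁ = ≤-<-trans (c≤K₁ 2c≡K₁) (<-trans K₁<T T<N)
  ... | inj₂ (_ , _ , c<T) = <-trans c<T T<N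

  c≢T : c ≢ T
  c≢T with c-centre
  ... | inj₁ 2c≡K₁ = λ c≡T → <-irrefl c≡T (≤-<-trans (c≤K₁ 2c≡K₁) K₁<T)
  ... | inj₂ (_ , _ , c<T) = <⇒≢ c<T

  centre-in-A : ∀ {a} → a ≤ K₁ → a ≡ c → 2 * a ≡ K₁
  centre-in-A a≤K₁ refl with c-centre
  ... | inj₁ 2c≡K₁ = 2c≡K₁
  ... | inj₂ (_ , L≤c , _) = ⊥-elim (<-irrefl refl (≤-<-trans a≤K₁ (<-≤-trans K₁<L L≤c)))

  centre-in-B : ∀ {a} → L ≤ a → a ≡ c → 2 * a ≡ K₂
  centre-in-B L≤a refl with c-centre
  ... | inj₁ 2c≡K₁ = ⊥-elim (<-irrefl refl (≤-<-trans (c≤K₁ 2c≡K₁) (<-≤-trans K₁<L L≤a)))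
  ... | inj₂ (2c≡K₂ , _) = 2c≡K₂

  LowPair HighPair : ℕ → ℕ → Set
  LowPair a b = a + b ≡ K₁ × a ≤ s
  HighPair a b = a + b ≡ K₂ × L ≤ a × a ≤ u

  OnLabels : (ℕ → ℕ → Set) → V n → V n → Set
  OnLabels P x y = ∃[ a ] ∃[ b ] (IsNum x a × IsNum y b × P a b)

  ToInfinity : V n → V n → Set
  ToInfinity x y = IsNum x c × y ≡ -∞ ⊎ IsNum x T × y ≡ +∞

  Adj₁ : V n → V n → Set
  Adj₁ x y = SymR (OnLabels LowPair) x y ⊎ SymR (OnLabels HighPair) x y ⊎ SymR ToInfinity x y

  same-label : ∀ {x : V n} {a b} → IsNum x a → IsNum x b → a ≡ b
  same-label xa xb = trans (sym (isNum-rank xa)) (isNum-rank xb)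

  partner-label : ∀ {a b K} → a + b ≡ K → b ≡ K ∸ a
  partner-label {a} {b} a+b≡K = trans (sym (m+n∸m≡n a b)) (cong (_∸ a) a+b≡K)

  A-pair : ∀ {a b} → a + b ≡ K₁ → a ≤ s → Adj₁ (unrank a) (unrank b) × a < b × b < N
  A-pair {a} {b} a+b≡K₁ a≤s =
    inj₁ (inj₁ (a , b , isNum-unrank (<-trans a<b b<N) , isNum-unrank b<N , a+b≡K₁ , a≤s)) , a<b , b<N
    where
    a<b = A.lower<upper a+b≡K₁ a≤s
    b<N = ≤-<-trans (subst (b ≤_) a+b≡K₁ (m≤n+m b a)) (<-trans K₁<T T<N)

  B-pair : ∀ {a b} → a + b ≡ K₂ → L ≤ a → a ≤ u → Adj₁ (unrank a) (unrank b) × a < b × b < N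
  B-pair {a} {b} a+b≡K₂ L≤a a≤u =
    inj₂ (inj₁ (inj₁ (a , b , isNum-unrank (<-trans a<b b<N) , isNum-unrank b<N , a+b≡K₂ , L≤a , a≤u))) , a<b , b<N
    where
    a<b = B.lower<upper a+b≡K₂ a≤u
    b<N = <-trans (below-T (≤-trans (+-monoʳ-≤ b L≤a) (≤-reflexive (trans (+-comm b a) a+b≡K₂)))) T<N

  symmetric₁ : ∀ {x y} → Adj₁ x y → Adj₁ y x
  symmetric₁ (inj₁ e) = inj₁ (SymR-swap {P = OnLabels LowPair} e)
  symmetric₁ (inj₂ (inj₁ e)) = inj₂ (inj₁ (SymR-swap {P = OnLabels HighPair} e))
  symmetric₁ (inj₂ (inj₂ e)) = inj₂ (inj₂ (SymR-swap {P = ToInfinity} e))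

  ν : ℕ → V n
  ν a with a ≟ c
  ... | yes _ = -∞
  ... | no _ with a ≤? K₁
  ... | yes _ = unrank (K₁ ∸ a)
  ... | no _ with a ≟ T
  ... | yes _ = +∞
  ... | no _ = unrank (K₂ ∸ a)

  -- the partner of a vertex of K_{2n} (the values at -i∞, i∞ do not matter)
  partner₁ : V n → V n
  partner₁ (num i) = ν (toℕ i)
  partner₁ -∞ = unrank c
  partner₁ +∞ = unrank T
  partner₁ -i∞ = -i∞
  partner₁ +i∞ = +i∞

  partner₁-num : ∀ {x a} → IsNum x a → partner₁ x ≡ ν a
  partner₁-num {num i} refl = refl

  ν-c : ν c ≡ -∞
  ν-c with c ≟ c
  ... | yes _ = refl
  ... | no c≢c = ⊥-elim (c≢c refl)

  ν-T : ν T ≡ +∞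
  ν-T with T ≟ c
  ... | yes T≡c = ⊥-elim (c≢T (sym T≡c))
  ... | no _ with T ≤? K₁
  ... | yes T≤K₁ = ⊥-elim (<⇒≱ K₁<T T≤K₁)
  ... | no _ with T ≟ T
  ... | yes _ = refl
  ... | no T≢T = ⊥-elim (T≢T refl)

  ν-A : ∀ {a} → a ≤ K₁ → 2 * a ≢ K₁ → ν a ≡ unrank (K₁ ∸ a)
  ν-A {a} a≤K₁ not-centre with a ≟ c
  ... | yes a≡c = ⊥-elim (not-centre (centre-in-A a≤K₁ a≡c))
  ... | no _ with a ≤? K₁
  ... | yes _ = refl
  ... | no a≰K₁ = ⊥-elim (a≰K₁ a≤K₁)

  ν-B : ∀ {a} → L ≤ a → a < T → 2 * a ≢ K₂ → ν a ≡ unrank (K₂ ∸ a)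
  ν-B {a} L≤a a<T not-centre with a ≟ c
  ... | yes a≡c = ⊥-elim (not-centre (centre-in-B L≤a a≡c))
  ... | no _ with a ≤? K₁
  ... | yes a≤K₁ = ⊥-elim (<⇒≱ (<-≤-trans K₁<L L≤a) a≤K₁)
  ... | no _ with a ≟ T
  ... | yes a≡T = ⊥-elim (<⇒≢ a<T a≡T)
  ... | no _ = refl

  A-partner : ∀ {x y a b} → IsNum x a → IsNum y b → a + b ≡ K₁ → 2 * a ≢ K₁ → y ≡ partner₁ x
  A-partner {x} {y} {a} {b} xa yb a+b≡K₁ not-centre = begin
    y               ≡⟨ isNum-≡ yb ⟩
    unrank b        ≡⟨ cong unrank (partner-label a+b≡K₁) ⟩
    unrank (K₁ ∸ a) ≡⟨ sym (ν-A (subst (a ≤_) a+b≡K₁ (m≤m+n a b)) not-centre) ⟩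
    ν a             ≡⟨ sym (partner₁-num xa) ⟩
    partner₁ x      ∎
    where open ≡-Reasoning

  B-partner : ∀ {x y a b} → IsNum x a → IsNum y b → a + b ≡ K₂ → L ≤ a → a + L ≤ K₂ → 2 * a ≢ K₂ →
              y ≡ partner₁ x
  B-partner {x} {y} {a} {b} xa yb a+b≡K₂ L≤a a+L≤K₂ not-centre = begin
    y               ≡⟨ isNum-≡ yb ⟩
    unrank b        ≡⟨ cong unrank (partner-label a+b≡K₂) ⟩
    unrank (K₂ ∸ a) ≡⟨ sym (ν-B L≤a (below-T a+L≤K₂) not-centre) ⟩
    ν a             ≡⟨ sym (partner₁-num xa) ⟩
    partner₁ x      ∎
    where open ≡-Reasoning

  determined₁ : ∀ {x y} → Adj₁ x y → y ≡ partner₁ x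
  determined₁ (inj₁ (inj₁ (a , b , xa , yb , a+b≡K₁ , a≤s))) =
    A-partner xa yb a+b≡K₁ (A.lower-not-centre a≤s)
  determined₁ (inj₁ (inj₂ (b , a , yb , xa , b+a≡K₁ , b≤s))) =
    A-partner xa yb (trans (+-comm a b) b+a≡K₁) (A.partner-not-centre b+a≡K₁ b≤s)
  determined₁ (inj₂ (inj₁ (inj₁ (a , b , xa , yb , a+b≡K₂ , L≤a , a≤u)))) =
    B-partner xa yb a+b≡K₂ L≤a (lower-in-B L≤a a≤u) (B.lower-not-centre a≤u)
  determined₁ (inj₂ (inj₁ (inj₂ (b , a , yb , xa , b+a≡K₂ , L≤b , b≤u)))) =
    B-partner xa yb (trans (+-comm a b) b+a≡K₂) (≤-trans L≤b (<⇒≤ b<a))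
      (≤-trans (+-monoʳ-≤ a L≤b) (≤-reflexive (trans (+-comm a b) b+a≡K₂)))
      (B.partner-not-centre b+a≡K₂ b≤u)
    where b<a = B.lower<upper b+a≡K₂ b≤u
  determined₁ (inj₂ (inj₂ (inj₁ (inj₁ (xc , refl))))) = sym (trans (partner₁-num xc) ν-c)
  determined₁ (inj₂ (inj₂ (inj₁ (inj₂ (xT , refl))))) = sym (trans (partner₁-num xT) ν-T)
  determined₁ (inj₂ (inj₂ (inj₂ (inj₁ (yc , refl))))) = isNum-≡ yc
  determined₁ (inj₂ (inj₂ (inj₂ (inj₂ (yT , refl))))) = isNum-≡ yT

  A-edge : ∀ {x a} → IsNum x a → a ≤ K₁ → a ≢ c → Adj₁ x (unrank (K₁ ∸ a))
  A-edge {x} {a} xa a≤K₁ a≢c = subst (λ z → Adj₁ z _) (sym (isNum-≡ xa)) (by-halves (A.halves (m+[n∸m]≡n a≤K₁)))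
    where
    by-halves : a ≤ s ⊎ K₁ ∸ a ≤ s ⊎ 2 * a ≡ K₁ → Adj₁ (unrank a) (unrank (K₁ ∸ a))
    by-halves (inj₁ a≤s) = proj₁ (A-pair (m+[n∸m]≡n a≤K₁) a≤s)
    by-halves (inj₂ (inj₁ b≤s)) = symmetric₁ (proj₁ (A-pair (m∸n+n≡m a≤K₁) b≤s))
    by-halves (inj₂ (inj₂ 2a≡K₁)) = ⊥-elim (a≢c (centre-unique (inj₁ 2a≡K₁)))

  B-edge : ∀ {x a} → IsNum x a → L ≤ a → a < T → a ≢ c → Adj₁ x (unrank (K₂ ∸ a))
  B-edge {x} {a} xa L≤a a<T a≢c = subst (λ z → Adj₁ z _) (sym (isNum-≡ xa)) (by-halves (B.halves (m+[n∸m]≡n a≤K₂)))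
    where
    a≤K₂ : a ≤ K₂
    a≤K₂ = ≤-trans (m≤m+n a L) (reflect-in-B a<T)
    L≤b : L ≤ K₂ ∸ a
    L≤b = m+n≤o⇒m≤o∸n L (subst (_≤ K₂) (+-comm a L) (reflect-in-B a<T))
    by-halves : a ≤ u ⊎ K₂ ∸ a ≤ u ⊎ 2 * a ≡ K₂ → Adj₁ (unrank a) (unrank (K₂ ∸ a))
    by-halves (inj₁ a≤u) = proj₁ (B-pair (m+[n∸m]≡n a≤K₂) L≤a a≤u)
    by-halves (inj₂ (inj₁ b≤u)) = symmetric₁ (proj₁ (B-pair (m∸n+n≡m a≤K₂) L≤b b≤u))
    by-halves (inj₂ (inj₂ 2a≡K₂)) = ⊥-elim (a≢c (centre-unique (inj₂ 2a≡K₂)))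

  total₁ : ∀ {x} → VK2n x → Adj₁ x (partner₁ x)
  total₁ {num i} _ with toℕ i ≟ c
  ... | yes i≡c = inj₂ (inj₂ (inj₁ (inj₁ (i≡c , refl))))
  ... | no i≢c with toℕ i ≤? K₁
  ... | yes i≤K₁ = A-edge refl i≤K₁ i≢c
  ... | no i≰K₁ with toℕ i ≟ T
  ... | yes i≡T = inj₂ (inj₂ (inj₁ (inj₂ (i≡T , refl))))
  ... | no i≢T = B-edge refl (subst (_≤ toℕ i) (sym L≡1+K₁) (≰⇒> i≰K₁))
                   (≤∧≢⇒< (≤-pred (subst (toℕ i <_) (sym 1+T≡N) (toℕ<n i))) i≢T) i≢c
  total₁ { -∞} _ = inj₂ (inj₂ (inj₂ (inj₁ (isNum-unrank c<N , refl))))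
  total₁ {+∞} _ = inj₂ (inj₂ (inj₂ (inj₂ (isNum-unrank T<N , refl))))

  irreflexive₁ : ∀ {x} → ¬ Adj₁ x x
  irreflexive₁ (inj₁ (inj₁ (_ , _ , xa , xb , a+b≡K₁ , a≤s))) = <⇒≢ (A.lower<upper a+b≡K₁ a≤s) (same-label xa xb)
  irreflexive₁ (inj₁ (inj₂ (_ , _ , xa , xb , a+b≡K₁ , a≤s))) = <⇒≢ (A.lower<upper a+b≡K₁ a≤s) (same-label xa xb)
  irreflexive₁ (inj₂ (inj₁ (inj₁ (_ , _ , xa , xb , a+b≡K₂ , _ , a≤u)))) = <⇒≢ (B.lower<upper a+b≡K₂ a≤u) (same-label xa xb)
  irreflexive₁ (inj₂ (inj₁ (inj₂ (_ , _ , xa , xb , a+b≡K₂ , _ , a≤u)))) = <⇒≢ (B.lower<upper a+b≡K₂ a≤u) (same-label xa xb)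
  irreflexive₁ (inj₂ (inj₂ (inj₁ (inj₁ (() , refl)))))
  irreflexive₁ (inj₂ (inj₂ (inj₁ (inj₂ (() , refl)))))
  irreflexive₁ (inj₂ (inj₂ (inj₂ (inj₁ (() , refl)))))
  irreflexive₁ (inj₂ (inj₂ (inj₂ (inj₂ (() , refl)))))

  numeric : ∀ {x : V n} {a} → IsNum x a → VK2n x
  numeric {num _} _ = tt

  inside₁ : ∀ {x y} → Adj₁ x y → VK2n x
  inside₁ (inj₁ (inj₁ (_ , _ , xa , _))) = numeric xa
  inside₁ (inj₁ (inj₂ (_ , _ , _ , xa , _))) = numeric xa
  inside₁ (inj₂ (inj₁ (inj₁ (_ , _ , xa , _)))) = numeric xa
  inside₁ (inj₂ (inj₁ (inj₂ (_ , _ , _ , xa , _)))) = numeric xa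
  inside₁ (inj₂ (inj₂ (inj₁ (inj₁ (xc , _))))) = numeric xc
  inside₁ (inj₂ (inj₂ (inj₁ (inj₂ (xT , _))))) = numeric xT
  inside₁ (inj₂ (inj₂ (inj₂ (inj₁ (_ , refl))))) = tt
  inside₁ (inj₂ (inj₂ (inj₂ (inj₂ (_ , refl))))) = tt

  matching₁ : Matching VK2n Adj₁
  matching₁ = record
    { partner = partner₁ ; symmetric = symmetric₁ ; inside = inside₁
    ; determined = determined₁ ; total = total₁ ; irreflexive = irreflexive₁ }


  pq-pair : Adj₁ (unrank p) (unrank q) × p < q × q < N
  pq-pair with pq-edge
  ... | inj₁ (p+q≡K₁ , p≤s) = A-pair p+q≡K₁ p≤s
  ... | inj₂ (p+q≡K₂ , L≤p , p≤u) = B-pair p+q≡K₂ L≤p p≤u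

  p<q : p < q
  p<q = proj₁ (proj₂ pq-pair)

  q<N : q < N
  q<N = proj₂ (proj₂ pq-pair)

  p<N : p < N
  p<N = <-trans p<q q<N

  classify : ∀ {x : V n} → VK2n+2 x → VK2n x ⊎ x ≡ -i∞ ⊎ x ≡ +i∞
  classify {num _} _ = inj₁ tt
  classify { -∞} _ = inj₁ tt
  classify {+∞} _ = inj₁ tt
  classify { -i∞} _ = inj₂ (inj₁ refl)
  classify {+i∞} _ = inj₂ (inj₂ refl)

  open Rewiring n>0 matching₁ {IsP = λ (x : V n) → IsNum x p} {IsQ = λ (x : V n) → IsNum x q} {α = -i∞} {β = +i∞}
    isNum-≡ (isNum-unrank p<N) isNum-≡ (isNum-unrank q<N) (proj₁ pq-pair) (λ ()) (λ ()) (λ ())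
    classify (λ _ → tt)
    renaming (Rewired to Adj₂; rewired to matching₂)


  -- the lower ends of the n edges of F₁¹
  data LowLabel (a : ℕ) : Set where
    in-A   : a ≤ s → LowLabel a
    in-B   : L ≤ a → a ≤ u → LowLabel a
    centre : a ≡ c → LowLabel a
    last   : a ≡ T → LowLabel a

  lowLabels : List ℕ
  lowLabels = interval 0 (suc s) ++ interval L (suc u) ++ c ∷ T ∷ []

  lowLabel⁻ : ∀ {a} → a ∈ lowLabels → LowLabel a
  lowLabel⁻ a∈ with ∈-++⁻ (interval 0 (suc s)) a∈
  ... | inj₁ a∈A = in-A (≤-pred (proj₂ (∈-interval⁻ {0} a∈A)))
  ... | inj₂ a∈rest with ∈-++⁻ (interval L (suc u)) a∈rest
  ... | inj₁ a∈B = in-B (proj₁ (∈-interval⁻ a∈B)) (≤-pred (proj₂ (∈-interval⁻ a∈B)))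
  ... | inj₂ (here a≡c) = centre a≡c
  ... | inj₂ (there (here a≡T)) = last a≡T

  lowLabel⁺ : ∀ {a} → LowLabel a → a ∈ lowLabels
  lowLabel⁺ (in-A a≤s) = ∈-++⁺ˡ (∈-interval⁺ z≤n (s≤s a≤s))
  lowLabel⁺ (in-B L≤a a≤u) = ∈-++⁺ʳ (interval 0 (suc s)) (∈-++⁺ˡ (∈-interval⁺ L≤a (s≤s a≤u)))
  lowLabel⁺ (centre a≡c) = ∈-++⁺ʳ (interval 0 (suc s)) (∈-++⁺ʳ (interval L (suc u)) (here a≡c))
  lowLabel⁺ (last a≡T) = ∈-++⁺ʳ (interval 0 (suc s)) (∈-++⁺ʳ (interval L (suc u)) (there (here a≡T)))

  lowLabel-bound : ∀ {a} → LowLabel a → a < N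
  lowLabel-bound (in-A a≤s) = ≤-<-trans a≤s (<-trans A.h<K (<-trans K₁<T T<N))
  lowLabel-bound (in-B L≤a a≤u) = <-trans (below-T (lower-in-B L≤a a≤u)) T<N
  lowLabel-bound (centre refl) = c<N
  lowLabel-bound (last refl) = T<N

  lower-end : ∀ {a b} → Adj₁ (unrank a) (unrank b) × a < b × b < N → ∃[ y ] (Adj₁ (unrank a) y × a < rank y)
  lower-end {a} {b} (r , a<b , b<N) = unrank b , r , subst (a <_) (sym (rank-unrank b<N)) a<b

  lowLabel-lower : ∀ {a} → LowLabel a → ∃[ y ] (Adj₁ (unrank a) y × a < rank y)
  lowLabel-lower {a} (in-A a≤s) = lower-end (A-pair (m+[n∸m]≡n (<⇒≤ (≤-<-trans a≤s A.h<K))) a≤s)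
  lowLabel-lower {a} (in-B L≤a a≤u) =
    lower-end (B-pair (m+[n∸m]≡n (≤-trans (m≤m+n a L) (lower-in-B L≤a a≤u))) L≤a a≤u)
  lowLabel-lower (centre refl) = -∞ , inj₂ (inj₂ (inj₁ (inj₁ (isNum-unrank c<N , refl)))) , c<N
  lowLabel-lower (last refl) =
    +∞ , inj₂ (inj₂ (inj₁ (inj₂ (isNum-unrank T<N , refl)))) , subst (T <_) (sym rank-+∞) (<-trans T<N (n<1+n N))

  rank-below-N : ∀ {y : V n} {a} → IsNum y a → rank y < N
  rank-below-N ya = subst (_< N) (sym (isNum-rank ya)) (isNum-bound ya)

  lower-listed : ∀ {x y} → Adj₁ x y → rank x < rank y → LowLabel (rank x)
  lower-listed (inj₁ (inj₁ (_ , _ , xa , _ , _ , a≤s))) _ = in-A (subst (_≤ s) (sym (isNum-rank xa)) a≤s)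
  lower-listed (inj₁ (inj₂ (_ , _ , yb , xa , b+a≡K₁ , b≤s))) x<y =
    ⊥-elim (<-asym x<y (subst₂ _<_ (sym (isNum-rank yb)) (sym (isNum-rank xa)) (A.lower<upper b+a≡K₁ b≤s)))
  lower-listed (inj₂ (inj₁ (inj₁ (_ , _ , xa , _ , _ , L≤a , a≤u)))) _ =
    in-B (subst (L ≤_) (sym (isNum-rank xa)) L≤a) (subst (_≤ u) (sym (isNum-rank xa)) a≤u)
  lower-listed (inj₂ (inj₁ (inj₂ (_ , _ , yb , xa , b+a≡K₂ , _ , b≤u)))) x<y =
    ⊥-elim (<-asym x<y (subst₂ _<_ (sym (isNum-rank yb)) (sym (isNum-rank xa)) (B.lower<upper b+a≡K₂ b≤u)))
  lower-listed (inj₂ (inj₂ (inj₁ (inj₁ (xc , _))))) _ = centre (isNum-rank xc)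
  lower-listed (inj₂ (inj₂ (inj₁ (inj₂ (xT , _))))) _ = last (isNum-rank xT)
  lower-listed (inj₂ (inj₂ (inj₂ (inj₁ (yc , refl))))) x<y = ⊥-elim (<-asym x<y (rank-below-N yc))
  lower-listed {y = y} (inj₂ (inj₂ (inj₂ (inj₂ (yT , refl))))) x<y =
    ⊥-elim (<-asym x<y (subst (rank y <_) (sym rank-+∞) (<-trans (rank-below-N yT) (n<1+n N))))

  lowLabels-unique : Unique lowLabels
  lowLabels-unique = ++⁺ (interval-unique 0 (suc s))
    (++⁺ (interval-unique L (suc u)) ((c≢T ∷ []) ∷ [] ∷ []) B-apart) A-apart
    where
    A-apart : ∀ {v} → ¬ (v ∈ interval 0 (suc s) × v ∈ interval L (suc u) ++ c ∷ T ∷ [])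
    A-apart (v∈A , v∈rest) with ≤-pred (proj₂ (∈-interval⁻ {0} v∈A)) | ∈-++⁻ (interval L (suc u)) v∈rest
    ... | v≤s | inj₁ v∈B = <⇒≱ (<-trans (≤-<-trans v≤s A.h<K) K₁<L) (proj₁ (∈-interval⁻ v∈B))
    ... | v≤s | inj₂ (there (here refl)) = <⇒≱ (<-trans (≤-<-trans v≤s A.h<K) K₁<T) ≤-refl
    ... | v≤s | inj₂ (here refl) with c-centre
    ...   | inj₁ 2c≡K₁ = A.lower-not-centre v≤s 2c≡K₁
    ...   | inj₂ (_ , L≤c , _) = <⇒≱ (<-trans (≤-<-trans v≤s A.h<K) K₁<L) L≤c
    B-apart : ∀ {v} → ¬ (v ∈ interval L (suc u) × v ∈ c ∷ T ∷ [])
    B-apart (v∈B , v∈ends) with ∈-interval⁻ v∈B | v∈ends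
    ... | L≤v , v<1+u | there (here refl) = <-irrefl refl (below-T (lower-in-B L≤v (≤-pred v<1+u)))
    ... | L≤v , v<1+u | here refl with c-centre
    ...   | inj₁ 2c≡K₁ = <⇒≱ (≤-<-trans (c≤K₁ 2c≡K₁) K₁<L) L≤v
    ...   | inj₂ (2c≡K₂ , _) = B.lower-not-centre (≤-pred v<1+u) 2c≡K₂

  length-lowLabels : length lowLabels ≡ n
  length-lowLabels = begin
    length lowLabels
      ≡⟨ length-++ (interval 0 (suc s)) ⟩
    length (interval 0 (suc s)) + length (interval L (suc u) ++ c ∷ T ∷ [])
      ≡⟨ cong₂ _+_ (length-applyUpTo (0 +_) (suc s)) (trans (length-++ (interval L (suc u))) (cong (_+ 2) (length-applyUpTo (L +_) (suc u ∸ L)))) ⟩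
    suc s + ((suc u ∸ L) + 2)
      ≡⟨ sym (+-assoc (suc s) (suc u ∸ L) 2) ⟩
    suc s + (suc u ∸ L) + 2
      ≡⟨ edge-count ⟩
    n ∎
    where open ≡-Reasoning

  lowVertices : List (V n)
  lowVertices = map unrank lowLabels

  lowVertices-unique : Unique lowVertices
  lowVertices-unique = map⁻ {f = rank} (subst Unique (sym ranks) lowLabels-unique)
    where
    ranks : map rank lowVertices ≡ lowLabels
    ranks = trans (sym (map-∘ lowLabels))
      (map-id-local (All.tabulate (λ a∈ → rank-unrank (lowLabel-bound (lowLabel⁻ a∈)))))

  survivors : List (V n)
  survivors = filter (λ x → ¬? (x ≟ᵥ unrank p)) lowVertices

  length-survivors : length survivors ≡ n ∸ 1
  length-survivors = cong (_∸ 1) (begin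
    suc (length survivors)  ≡⟨ length-delete _≟ᵥ_ {xs = lowVertices} lowVertices-unique (∈-map⁺ unrank (lowLabel⁺ p-low)) ⟩
    length lowVertices      ≡⟨ length-map unrank lowLabels ⟩
    length lowLabels        ≡⟨ length-lowLabels ⟩
    n                       ∎)
    where
    open ≡-Reasoning
    p-low : LowLabel p
    p-low with pq-edge
    ... | inj₁ (_ , p≤s) = in-A p≤s
    ... | inj₂ (_ , L≤p , p≤u) = in-B L≤p p≤u

  survivor-lower : ∀ {x} → x ∈ survivors → ∃[ y ] (Adj₁ x y × rank x < rank y)
  survivor-lower x∈ with ∈-map⁻ unrank (proj₁ (∈-filter⁻ (λ x → ¬? (x ≟ᵥ unrank p)) x∈))
  ... | a , a∈ , refl with lowLabel-lower (lowLabel⁻ a∈)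
  ...   | y , r , a<y = y , r , subst (_< rank y) (sym (rank-unrank (lowLabel-bound (lowLabel⁻ a∈)))) a<y

  common : CommonCount (λ e → Adj₁ (lo e) (hi e)) (λ e → Adj₂ (lo e) (hi e)) (n ∸ 1)
  common with edgesAbove matching₁ survivors (filter⁺ (λ x → ¬? (x ≟ᵥ unrank p)) lowVertices-unique) survivor-lower
  ... | es , unique-es , length-es , es-spec = es , unique-es , trans length-es length-survivors , λ e → to e , from e
    where
    P<Q : rank (unrank p) < rank (unrank q)
    P<Q = subst₂ _<_ (sym (rank-unrank p<N)) (sym (rank-unrank q<N)) p<q

    to : ∀ e → e ∈ es → Adj₁ (lo e) (hi e) × Adj₂ (lo e) (hi e)
    to e e∈es with proj₁ (es-spec e) e∈es
    ... | r , lo∈ = r , survives P<Q r (ord e) (proj₂ (∈-filter⁻ (λ x → ¬? (x ≟ᵥ unrank p)) {xs = lowVertices} lo∈))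

    from : ∀ e → Adj₁ (lo e) (hi e) × Adj₂ (lo e) (hi e) → e ∈ es
    from e (r , r₂) = proj₂ (es-spec e) (r , ∈-filter⁺ (λ x → ¬? (x ≟ᵥ unrank p)) {xs = lowVertices} lo∈ lo≢P)
      where
      lo∈ : lo e ∈ lowVertices
      lo∈ = subst (_∈ lowVertices) (unrank-rank (lo e)) (∈-map⁺ unrank (lowLabel⁺ (lower-listed r (ord e))))
      lo≢P : lo e ≢ unrank p
      lo≢P lo≡P = deleted (subst (λ z → Adj₁ z (hi e)) lo≡P r) (subst (λ z → Adj₂ z (hi e)) lo≡P r₂)

  result : IsOneFactor VK2n (λ e → Adj₁ (lo e) (hi e)) × IsOneFactor VK2n+2 (λ e → Adj₂ (lo e) (hi e)) ×
           CommonCount (λ e → Adj₁ (lo e) (hi e)) (λ e → Adj₂ (lo e) (hi e)) (n ∸ 1)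
  result = matching⇒oneFactor matching₁ , matching⇒oneFactor matching₂ , common
    where open OneFactors n>0

≤-by : ∀ {a b} d → a + d ≡ b → a ≤ b
≤-by {a} d a+d≡b = subst (a ≤_) a+d≡b (m≤m+n a d)

∸-by : ∀ {a b} d → a + d ≡ b → b ∸ a ≡ d
∸-by {a} d a+d≡b = trans (cong (_∸ a) (sym a+d≡b)) (m+n∸m≡n a d)

-- the layout for even n = 2m + 4: s = m, u = 3m + 3, c = m + 1, {p, q} = {u, u + 1}
evenLayout : ∀ m → Layout (4 + (m + m)) (2 + (m + m)) m (6 * m + 7) (3 + (m + m)) (3 * m + 3) (suc m)
                          (4 * m + 5) (3 * m + 3) (3 * m + 4)
evenLayout m = record
  { L≡1+K₁ = refl
  ; L≤T = ≤-by (2 * m + 2) (L+d≡T m)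
  ; T+L≡1+K₂ = T+L m
  ; 1+T≡N = sym (cong (_∸ 2) (2n m))
  ; s-lower = ≤-by 1 (2s+2 m)
  ; s-upper = ≤-reflexive (cong (2 +_) (sym (2*m m)))
  ; u-lower = ≤-reflexive (sym (K₂-odd m))
  ; u-upper = ≤-by 1 (K₂+1 m)
  ; c-centre = inj₁ 2c≡K₁
  ; centre-unique = λ
    { {a} (inj₁ 2a≡K₁) → *-cancelˡ-≡ a (suc m) 2 (trans 2a≡K₁ (sym 2c≡K₁))
    ; {a} (inj₂ 2a≡K₂) → ⊥-elim (even≢odd a (3 * m + 3) (trans 2a≡K₂ (K₂-odd m))) }
  ; pq-edge = inj₂ (p+q m , ≤-by m (L+m m) , ≤-refl)
  ; edge-count = trans (cong (λ k → suc m + k + 2) (∸-by {3 + (m + m)} (suc m) (L+B m))) (count m)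
  }
  where
  2*m : ∀ m → 2 * m ≡ m + m
  2*m = solve-∀
  2c≡K₁ : 2 * suc m ≡ 2 + (m + m)
  2c≡K₁ = centre m
    where
    centre : ∀ m → 2 * suc m ≡ 2 + (m + m)
    centre = solve-∀
  L+d≡T : ∀ m → 3 + (m + m) + (2 * m + 2) ≡ 4 * m + 5
  L+d≡T = solve-∀
  T+L : ∀ m → 4 * m + 5 + (3 + (m + m)) ≡ suc (6 * m + 7)
  T+L = solve-∀
  2n : ∀ m → 2 * (4 + (m + m)) ≡ 2 + suc (4 * m + 5)
  2n = solve-∀
  2s+2 : ∀ m → suc (2 * m) + 1 ≡ 2 + (m + m)
  2s+2 = solve-∀
  K₂-odd : ∀ m → 6 * m + 7 ≡ suc (2 * (3 * m + 3))
  K₂-odd = solve-∀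
  K₂+1 : ∀ m → 6 * m + 7 + 1 ≡ 2 + 2 * (3 * m + 3)
  K₂+1 = solve-∀
  p+q : ∀ m → 3 * m + 3 + (3 * m + 4) ≡ 6 * m + 7
  p+q = solve-∀
  L+m : ∀ m → 3 + (m + m) + m ≡ 3 * m + 3
  L+m = solve-∀
  L+B : ∀ m → 3 + (m + m) + suc m ≡ suc (3 * m + 3)
  L+B = solve-∀
  count : ∀ m → suc m + suc m + 2 ≡ 4 + (m + m)
  count = solve-∀

-- the layout for odd n = 2m + 3: s = m, u = 3m + 1, c = 3m + 2, {p, q} = {s, s + 1}
oddLayout : ∀ m → Layout (3 + (m + m)) (1 + (m + m)) m (6 * m + 4) (2 + (m + m)) (3 * m + 1) (3 * m + 2)
                         (4 * m + 3) m (suc m)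
oddLayout m = record
  { L≡1+K₁ = refl
  ; L≤T = ≤-by (2 * m + 1) (L+d≡T m)
  ; T+L≡1+K₂ = T+L m
  ; 1+T≡N = sym (cong (_∸ 2) (2n m))
  ; s-lower = ≤-reflexive (cong suc (2*m m))
  ; s-upper = ≤-by 1 (2s+2 m)
  ; u-lower = ≤-by 1 (2u+2 m)
  ; u-upper = ≤-reflexive (K₂-even m)
  ; c-centre = inj₂ (2c≡K₂ , ≤-by m (L+m m) , ≤-by m (c+m m))
  ; centre-unique = λ
    { {a} (inj₁ 2a≡K₁) → ⊥-elim (even≢odd a m (trans 2a≡K₁ (cong suc (sym (2*m m)))))
    ; {a} (inj₂ 2a≡K₂) → *-cancelˡ-≡ a (3 * m + 2) 2 (trans 2a≡K₂ (sym 2c≡K₂)) }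
  ; pq-edge = inj₁ (+-suc m m , ≤-refl)
  ; edge-count = trans (cong (λ k → suc m + k + 2) (∸-by {2 + (m + m)} m (L+B m))) (count m)
  }
  where
  2*m : ∀ m → 2 * m ≡ m + m
  2*m = solve-∀
  2c≡K₂ : 2 * (3 * m + 2) ≡ 6 * m + 4
  2c≡K₂ = centre m
    where
    centre : ∀ m → 2 * (3 * m + 2) ≡ 6 * m + 4
    centre = solve-∀
  L+d≡T : ∀ m → 2 + (m + m) + (2 * m + 1) ≡ 4 * m + 3
  L+d≡T = solve-∀
  T+L : ∀ m → 4 * m + 3 + (2 + (m + m)) ≡ suc (6 * m + 4)
  T+L = solve-∀
  2n : ∀ m → 2 * (3 + (m + m)) ≡ 2 + suc (4 * m + 3)
  2n = solve-∀
  2s+2 : ∀ m → 1 + (m + m) + 1 ≡ 2 + 2 * m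
  2s+2 = solve-∀
  2u+2 : ∀ m → suc (2 * (3 * m + 1)) + 1 ≡ 6 * m + 4
  2u+2 = solve-∀
  K₂-even : ∀ m → 6 * m + 4 ≡ 2 + 2 * (3 * m + 1)
  K₂-even = solve-∀
  L+m : ∀ m → 2 + (m + m) + m ≡ 3 * m + 2
  L+m = solve-∀
  c+m : ∀ m → suc (3 * m + 2) + m ≡ 4 * m + 3
  c+m = solve-∀
  L+B : ∀ m → 2 + (m + m) + m ≡ suc (3 * m + 1)
  L+B = solve-∀
  count : ∀ m → suc m + m + 2 ≡ 3 + (m + m)
  count = solve-∀

DefsLayout : ℕ → Set
DefsLayout n = Layout n (n ∸ 2) (sP n) (3 * n ∸ 5) (n ∸ 1) (uP n) (cP n) (2 * n ∸ 3) (pP n) (qP n)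

layout-transport : ∀ {n K₁ s s′ K₂ K₂′ L u u′ c c′ T T′ p p′ q q′} →
  s ≡ s′ → K₂ ≡ K₂′ → u ≡ u′ → c ≡ c′ → T ≡ T′ → p ≡ p′ → q ≡ q′ →
  Layout n K₁ s′ K₂′ L u′ c′ T′ p′ q′ → Layout n K₁ s K₂ L u c T p q
layout-transport refl refl refl refl refl refl refl layout = layout

isEven-double : ∀ m → isEven (m + m) ≡ true
isEven-double zero = refl
isEven-double (suc m) rewrite +-suc m m = isEven-double m

isEven-odd : ∀ m → isEven (suc (m + m)) ≡ false
isEven-odd zero = refl
isEven-odd (suc m) rewrite +-suc m m = isEven-odd m

if-true : ∀ {A : Set} {b} (x y : A) → b ≡ true → (if b then x else y) ≡ x
if-true x y refl = refl

if-false : ∀ {A : Set} {b} (x y : A) → b ≡ false → (if b then x else y) ≡ y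
if-false x y refl = refl

halve : ∀ {a} k → a ≡ k + k → ⌊ a /2⌋ ≡ k
halve k refl = sym (n≡⌊n+n/2⌋ k)

even-labels : ∀ m → DefsLayout (4 + (m + m))
even-labels m = layout-transport s≡ K₂≡ u≡ c≡ T≡ (trans p-is-u u≡) (trans q-is-v (∸-by {3 * m + 3} (3 * m + 4) (u+v m)))
  (evenLayout m)
  where
  n = 4 + (m + m)
  even : isEven n ≡ true
  even = isEven-double m
  s≡ : sP n ≡ m
  s≡ = trans (if-true _ _ even) (halve m refl)
  K₂≡ : 3 * n ∸ 5 ≡ 6 * m + 7
  K₂≡ = ∸-by {5} (6 * m + 7) (3n m)
    where
    3n : ∀ m → 5 + (6 * m + 7) ≡ 3 * (4 + (m + m))
    3n = solve-∀
  u≡ : uP n ≡ 3 * m + 3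
  u≡ = trans (if-true _ _ even) (halve (3 * m + 3) (∸-by {6} ((3 * m + 3) + (3 * m + 3)) (3n m)))
    where
    3n : ∀ m → 6 + ((3 * m + 3) + (3 * m + 3)) ≡ 3 * (4 + (m + m))
    3n = solve-∀
  c≡ : cP n ≡ suc m
  c≡ = trans (if-true _ _ even) (cong suc (halve m refl))
  T≡ : 2 * n ∸ 3 ≡ 4 * m + 5
  T≡ = ∸-by {3} (4 * m + 5) (2n m)
    where
    2n : ∀ m → 3 + (4 * m + 5) ≡ 2 * (4 + (m + m))
    2n = solve-∀
  p-is-u : pP n ≡ uP n
  p-is-u = if-true _ _ even
  q-is-v : qP n ≡ 6 * m + 7 ∸ (3 * m + 3)
  q-is-v = trans (if-true _ _ even) (cong₂ _∸_ K₂≡ u≡)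
  u+v : ∀ m → 3 * m + 3 + (3 * m + 4) ≡ 6 * m + 7
  u+v = solve-∀

odd-labels : ∀ m → DefsLayout (3 + (m + m))
odd-labels m = layout-transport s≡ K₂≡ u≡ c≡ T≡ (trans p-is-s s≡) (trans q-is-t (∸-by {m} (suc m) (+-suc m m)))
  (oddLayout m)
  where
  n = 3 + (m + m)
  odd : isEven n ≡ false
  odd = isEven-odd m
  s≡ : sP n ≡ m
  s≡ = trans (if-false _ _ odd) (halve m refl)
  K₂≡ : 3 * n ∸ 5 ≡ 6 * m + 4
  K₂≡ = ∸-by {5} (6 * m + 4) (3n m)
    where
    3n : ∀ m → 5 + (6 * m + 4) ≡ 3 * (3 + (m + m))
    3n = solve-∀
  u≡ : uP n ≡ 3 * m + 1
  u≡ = trans (if-false _ _ odd) (halve (3 * m + 1) (∸-by {7} ((3 * m + 1) + (3 * m + 1)) (3n m)))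
    where
    3n : ∀ m → 7 + ((3 * m + 1) + (3 * m + 1)) ≡ 3 * (3 + (m + m))
    3n = solve-∀
  c≡ : cP n ≡ 3 * m + 2
  c≡ = trans (if-false _ _ odd) (halve (3 * m + 2) (∸-by {5} ((3 * m + 2) + (3 * m + 2)) (3n m)))
    where
    3n : ∀ m → 5 + ((3 * m + 2) + (3 * m + 2)) ≡ 3 * (3 + (m + m))
    3n = solve-∀
  T≡ : 2 * n ∸ 3 ≡ 4 * m + 3
  T≡ = ∸-by {3} (4 * m + 3) (2n m)
    where
    2n : ∀ m → 3 + (4 * m + 3) ≡ 2 * (3 + (m + m))
    2n = solve-∀
  p-is-s : pP n ≡ sP n
  p-is-s = if-false _ _ odd
  q-is-t : qP n ≡ suc (m + m) ∸ m
  q-is-t = trans (if-false _ _ odd) (cong (suc (m + m) ∸_) s≡)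

data Parity : ℕ → Set where
  even : ∀ m → Parity (4 + (m + m))
  odd  : ∀ m → Parity (3 + (m + m))

parity : ∀ k → Parity (3 + k)
parity zero = odd 0
parity (suc k) with parity k
... | odd m = even m
... | even m = subst Parity (cong (4 +_) (+-suc m m)) (odd (suc m))

defsLayout : ∀ {n} → Parity n → DefsLayout n
defsLayout (even m) = even-labels m
defsLayout (odd m) = odd-labels m

lemma4p1 : (n : ℕ) → 3 ≤ n →
    IsOneFactor VK2n (F₁¹ n) × IsOneFactor VK2n+2 (F₁² n) × CommonCount (F₁¹ n) (F₁² n) (n ∸ 1)
lemma4p1 n 3≤n = Construction.result n (n ∸ 2) (sP n) (3 * n ∸ 5) (n ∸ 1) (uP n) (cP n) (2 * n ∸ 3) (pP n) (qP n)
  (≤-trans (s≤s z≤n) 3≤n) (defsLayout (subst Parity (m+[n∸m]≡n 3≤n) (parity (n ∸ 3))))
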